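{- Let $G_1$ and $G_2$ be paths of lengths $l_1$ and $l_2$ (numbers of edges). Then the Cartesian product $G_1\,\square\, G_2$ has an induced path of length at least $l_1 l_2/2$.
   Context: The Cartesian product $G_1\square G_2$ of graphs $G_1=(V_1,E_1)$, $G_2=(V_2,E_2)$ has vertex set $V_1\times V_2$, with $(u_1,u_2)$ adjacent to $(v_1,v_2)$ iff either $u_1=v_1$ and $u_2v_2\in E_2$, or $u_2=v_2$ and $u_1v_1\in E_1$. -}

module Defs where

open import Level using (Level; _⊔_) renaming (suc to lsuc)
open import Data.Nat using (ℕ; suc)
open import Data.Fin using (Fin; toℕ)
open import Data.Product using (_×_; Σ)
open import Data.Sum using (_⊎_)
open import Relation.Binary.PropositionalEquality using (_≡_)
open import Function.Definitions using (Injective)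

record Graph : Set₁ where
  field
    V   : Set
    Adj : V → V → Set
open Graph public

Consecutive : ℕ → ℕ → Set
Consecutive i j = (suc i ≡ j) ⊎ (suc j ≡ i)

PathGraph : ℕ → Graph
PathGraph l = record
  { V   = Fin (suc l)
  ; Adj = λ i j → Consecutive (toℕ i) (toℕ j) }

_□_ : Graph → Graph → Graph
G₁ □ G₂ = record
  { V   = V G₁ × V G₂
  ; Adj = λ u v →
      ((Data.Product.proj₁ u ≡ Data.Product.proj₁ v) × Adj G₂ (Data.Product.proj₂ u) (Data.Product.proj₂ v))
      ⊎ ((Data.Product.proj₂ u ≡ Data.Product.proj₂ v) × Adj G₁ (Data.Product.proj₁ u) (Data.Product.proj₁ v)) }

record InducedPath (G : Graph) (k : ℕ) : Set where
  field
    vert    : Fin (suc k) → V G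
    inj     : Injective _≡_ _≡_ vert
    adj→    : ∀ i j → Consecutive (toℕ i) (toℕ j) → Adj G (vert i) (vert j)
    adj←    : ∀ i j → Adj G (vert i) (vert j) → Consecutive (toℕ i) (toℕ j)

-- Put w = l₂ and b = ⌊l₁/2⌋. The snake that runs along row 0, steps down to
-- (1, w), and then follows the snake for b - 1 mirrored left-to-right and moved
-- two rows down, traverses the rows 0, 2, …, 2b and has (b + 1) w + 2b ≥ l₁ l₂ / 2
-- edges. Grid vertices are adjacent iff their ℓ¹ distance is 1, so being an
-- induced path is a condition on the ℓ¹ distances between the points of the
-- sequence. The mirror is an isometry on the grid, and a concatenation keeps the
-- condition once the distances across the junction are checked: row 0 and the
-- mirrored snake lie two rows apart, and the corner (1, w) is one step further from
-- each point of the mirrored snake than (0, 0) is from the original point.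
module Submission where

open import Defs
open import Data.Nat using (ℕ; _*_; _≤_)
open import Data.Product using (Σ; _×_)

open import Data.Nat using (zero; suc; _+_; _∸_; ∣_-_∣; ⌊_/2⌋; z≤n; s≤s; s≤s⁻¹)
open import Data.Nat.Properties
open import Data.Nat.Solver using (module +-*-Solver)
open import Data.Fin using (Fin; toℕ; fromℕ<)
open import Data.Fin.Properties using (toℕ-fromℕ<; toℕ-injective; toℕ<n)
open import Data.Product using (_,_; proj₁; proj₂)
open import Data.Sum using (_⊎_; inj₁; inj₂)
open import Function using (_∘_)
open import Relation.Binary.PropositionalEquality

Point : Set
Point = ℕ × ℕ

dist : Point → Point → ℕ
dist (a , b) (c , e) = ∣ a - c ∣ + ∣ b - e ∣

dist-self : ∀ p → dist p p ≡ 0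
dist-self (a , b) = cong₂ _+_ (∣n-n∣≡0 a) (∣n-n∣≡0 b)

dist-sym : ∀ p q → dist p q ≡ dist q p
dist-sym (a , b) (c , e) = cong₂ _+_ (∣-∣-comm a c) (∣-∣-comm b e)

infix 4 _≈₂_
_≈₂_ : ℕ → ℕ → Set
zero        ≈₂ x = x ≡ 0
suc zero    ≈₂ x = x ≡ 1
suc (suc n) ≈₂ x = 2 ≤ x

≈₂-refl : ∀ n → n ≈₂ n
≈₂-refl zero          = refl
≈₂-refl (suc zero)    = refl
≈₂-refl (suc (suc n)) = s≤s (s≤s z≤n)

≈₂-suc : ∀ n {x} → n ≈₂ x → suc n ≈₂ suc x
≈₂-suc zero          refl = refl
≈₂-suc (suc zero)    refl = ≤-refl
≈₂-suc (suc (suc n)) 2≤x  = m≤n⇒m≤1+n 2≤x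

≈₂-far : ∀ m u {x} → 2 ≤ x → suc (m + suc u) ≈₂ x
≈₂-far m u 2≤x rewrite +-suc m u = 2≤x

≈₂-small : ∀ n {x} → n ≈₂ x → x ≤ 1 → n ≡ x
≈₂-small zero          x≡0 _ = sym x≡0
≈₂-small (suc zero)    x≡1 _ = sym x≡1
≈₂-small (suc (suc n)) 2≤x x≤1 with ≤-trans 2≤x x≤1
... | s≤s ()

≈₂-dist-cong : ∀ {n n′ p p′ q q′} → n ≡ n′ → p ≡ p′ → q ≡ q′ →
               n ≈₂ dist p q → n′ ≈₂ dist p′ q′
≈₂-dist-cong refl refl refl n≈₂d = n≈₂d

-- Points n steps apart along f are equal, adjacent or non-adjacent in the grid
-- according as n = 0, n = 1 or n ≥ 2.
InducedWalk : ℕ → (ℕ → Point) → Set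
InducedWalk k f = ∀ i n → i + n ≤ k → n ≈₂ dist (f i) (f (i + n))

InducedWalk-0 : ∀ {f} → InducedWalk 0 f
InducedWalk-0 {f} zero zero z≤n = dist-self (f 0)

InducedWalk-map : ∀ {k f} (h : Point → Point) →
                  (∀ i j → i ≤ k → j ≤ k → dist (h (f i)) (h (f j)) ≡ dist (f i) (f j)) →
                  InducedWalk k f → InducedWalk k (h ∘ f)
InducedWalk-map {k} h iso walk i n i+n≤k =
  subst (n ≈₂_) (sym (iso i (i + n) (m+n≤o⇒m≤o i i+n≤k) i+n≤k)) (walk i n i+n≤k)

InducedWalk-dist-≤ : ∀ {k f i j} → InducedWalk k f → i ≤ j → j ≤ k →
                     ∣ i - j ∣ ≈₂ dist (f i) (f j)
InducedWalk-dist-≤ {k} {f} {i} {j} walk i≤j j≤k =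
  subst₂ _≈₂_ (sym (m≤n⇒∣m-n∣≡n∸m i≤j)) (cong (dist (f i) ∘ f) i+[j∸i]≡j)
    (walk i (j ∸ i) (subst (_≤ k) (sym i+[j∸i]≡j) j≤k))
  where
  i+[j∸i]≡j : i + (j ∸ i) ≡ j
  i+[j∸i]≡j = m+[n∸m]≡n i≤j

InducedWalk-dist : ∀ {k f i j} → InducedWalk k f → i ≤ k → j ≤ k →
                   ∣ i - j ∣ ≈₂ dist (f i) (f j)
InducedWalk-dist {k} {f} {i} {j} walk i≤k j≤k with ≤-total i j
... | inj₁ i≤j = InducedWalk-dist-≤ {f = f} walk i≤j j≤k
... | inj₂ j≤i = subst₂ _≈₂_ (∣-∣-comm j i) (dist-sym (f j) (f i))
                   (InducedWalk-dist-≤ {f = f} walk j≤i i≤k)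

-- join n f g runs through f 0, …, f n, g 0, g 1, …
join : ∀ {A : Set} → ℕ → (ℕ → A) → (ℕ → A) → ℕ → A
join n       f g zero    = f zero
join zero    f g (suc t) = g t
join (suc n) f g (suc t) = join n (f ∘ suc) g t

join-below : ∀ {A : Set} {n} {f g : ℕ → A} {t} → t ≤ n → join n f g t ≡ f t
join-below {t = zero}  _ = refl
join-below {n = suc n} {t = suc t} (s≤s t≤n) = join-below {n = n} t≤n

join-above : ∀ {A : Set} n {f g : ℕ → A} u → join n f g (suc (n + u)) ≡ g u
join-above zero    u = refl
join-above (suc n) u = join-above n u

join-∀ : ∀ {A : Set} {n k} {f g : ℕ → A} (P : A → Set) →
         (∀ t → t ≤ n → P (f t)) → (∀ u → u ≤ k → P (g u)) →
         ∀ t → t ≤ suc (n + k) → P (join n f g t)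
join-∀              P Pf Pg zero    _         = Pf zero z≤n
join-∀ {n = zero}    P Pf Pg (suc t) (s≤s t≤k) = Pg t t≤k
join-∀ {n = suc n}   P Pf Pg (suc t) (s≤s t≤) = join-∀ {n = n} P (λ t t≤n → Pf (suc t) (s≤s t≤n)) Pg t t≤

data Split (n t : ℕ) : Set where
  below : t ≤ n → Split n t
  above : ∀ u → t ≡ suc (n + u) → Split n t

split : ∀ n t → Split n t
split zero    zero    = below z≤n
split zero    (suc t) = above t refl
split (suc n) zero    = below z≤n
split (suc n) (suc t) with split n t
... | below t≤n  = below (s≤s t≤n)
... | above u eq = above u (cong suc eq)

-- f i and g v lie suc (m + v) steps apart in join n f g when i + m ≡ n.
Cross : ℕ → ℕ → (ℕ → Point) → (ℕ → Point) → Set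
Cross n k f g = ∀ i m v → i + m ≡ n → v ≤ k → suc (m + v) ≈₂ dist (f i) (g v)

join-walk : ∀ {n k f g} → InducedWalk n f → InducedWalk k g → Cross n k f g →
            InducedWalk (suc (n + k)) (join n f g)
join-walk {n} {k} {f} {g} walk-f walk-g cross i d i+d≤ with split n i
... | above u refl =
  ≈₂-dist-cong refl (sym (join-above n u)) (sym shifted)
    (walk-g u d (+-cancelˡ-≤ n (u + d) k (subst (_≤ n + k) (+-assoc n u d) (s≤s⁻¹ i+d≤))))
  where
  shifted : join n f g (suc (n + u) + d) ≡ g (u + d)
  shifted = trans (cong (join n f g ∘ suc) (+-assoc n u d)) (join-above n (u + d))
... | below i≤n with split n (i + d)
...   | below i+d≤n =
  ≈₂-dist-cong refl (sym (join-below i≤n)) (sym (join-below i+d≤n))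
    (walk-f i d i+d≤n)
...   | above v i+d≡ =
  ≈₂-dist-cong (sym d≡) (sym (join-below i≤n)) (sym (trans (cong (join n f g) i+d≡) (join-above n v)))
    (cross i (n ∸ i) v i+m≡n v≤k)
  where
  i+m≡n : i + (n ∸ i) ≡ n
  i+m≡n = m+[n∸m]≡n i≤n
  v≤k : v ≤ k
  v≤k = +-cancelˡ-≤ n v k (s≤s⁻¹ (subst (_≤ suc (n + k)) i+d≡ i+d≤))
  d≡ : d ≡ suc (n ∸ i + v)
  d≡ = +-cancelˡ-≡ i d _ (begin
    i + d                  ≡⟨ i+d≡ ⟩
    suc (n + v)            ≡⟨ cong (λ x → suc (x + v)) (sym i+m≡n) ⟩
    suc (i + (n ∸ i) + v)  ≡⟨ cong suc (+-assoc i _ v) ⟩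
    suc (i + (n ∸ i + v))  ≡⟨ sym (+-suc i _) ⟩
    i + suc (n ∸ i + v)    ∎)
    where open ≡-Reasoning

row : ℕ → Point
row t = (0 , t)

row-walk : ∀ {k} → InducedWalk k row
row-walk i n _ = subst (n ≈₂_) (sym (∣m-m+n∣≡n i n)) (≈₂-refl n)

∣w∸c-w∸c′∣≡∣c-c′∣ : ∀ w {c c′} → c ≤ w → c′ ≤ w → ∣ w ∸ c - w ∸ c′ ∣ ≡ ∣ c - c′ ∣
∣w∸c-w∸c′∣≡∣c-c′∣ w {zero} {c′} _ c′≤w =
  trans (m≤n⇒∣n-m∣≡n∸m (m∸n≤m w c′)) (m∸[m∸n]≡n c′≤w)
∣w∸c-w∸c′∣≡∣c-c′∣ w {suc c} {zero} c≤w _ =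
  trans (∣-∣-comm (w ∸ suc c) w) (∣w∸c-w∸c′∣≡∣c-c′∣ w {zero} z≤n c≤w)
∣w∸c-w∸c′∣≡∣c-c′∣ (suc w) {suc c} {suc c′} (s≤s c≤w) (s≤s c′≤w) =
  ∣w∸c-w∸c′∣≡∣c-c′∣ w c≤w c′≤w

reflect : ℕ → Point → Point
reflect w (r , c) = (suc (suc r) , w ∸ c)

reflect-dist : ∀ {w} p q → proj₂ p ≤ w → proj₂ q ≤ w → dist (reflect w p) (reflect w q) ≡ dist p q
reflect-dist {w} (r , c) (r′ , c′) c≤w c′≤w = cong (∣ r - r′ ∣ +_) (∣w∸c-w∸c′∣≡∣c-c′∣ w c≤w c′≤w)

corner-reflect-dist : ∀ {w} p → proj₂ p ≤ w → dist (1 , w) (reflect w p) ≡ suc (dist (0 , 0) p)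
corner-reflect-dist {w} (r , c) c≤w = cong (suc r +_) (∣w∸c-w∸c′∣≡∣c-c′∣ w z≤n c≤w)

hook : ℕ → (ℕ → Point) → ℕ → Point
hook w g = join 0 (λ _ → (1 , w)) (reflect w ∘ g)

hook-walk : ∀ {w k g} → InducedWalk k g → g 0 ≡ (0 , 0) → (∀ t → t ≤ k → proj₂ (g t) ≤ w) →
            InducedWalk (suc k) (hook w g)
hook-walk {w} {k} {g} walk g0≡0 col≤w =
  join-walk (InducedWalk-0 {λ _ → (1 , w)}) (InducedWalk-map {f = g} (reflect w) iso walk) cross
  where
  iso : ∀ i j → i ≤ k → j ≤ k → dist (reflect w (g i)) (reflect w (g j)) ≡ dist (g i) (g j)
  iso i j i≤k j≤k = reflect-dist (g i) (g j) (col≤w i i≤k) (col≤w j j≤k)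
  cross : Cross 0 k (λ _ → (1 , w)) (reflect w ∘ g)
  cross zero zero v refl v≤k =
    subst (suc v ≈₂_) (sym (corner-reflect-dist (g v) (col≤w v v≤k)))
      (≈₂-suc v (subst (λ p → v ≈₂ dist p (g v)) g0≡0 (walk 0 v v≤k)))

row-hook-cross : ∀ {w k g} → Cross w (suc k) row (hook w g)
row-hook-cross {w} i m zero i+m≡w _ =
  subst (λ x → suc (m + 0) ≈₂ suc x) m+0≡∣i-w∣ (≈₂-refl (suc (m + 0)))
  where
  m+0≡∣i-w∣ : m + 0 ≡ ∣ i - w ∣
  m+0≡∣i-w∣ = trans (+-identityʳ m) (sym (trans (cong (∣ i -_∣) (sym i+m≡w)) (∣m-m+n∣≡n i m)))
row-hook-cross i m (suc u) _ _ = ≈₂-far m u (s≤s (s≤s z≤n))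

snake : ℕ → ℕ → ℕ → Point
snake w zero    = row
snake w (suc b) = join w row (hook w (snake w b))

snakeLength : ℕ → ℕ → ℕ
snakeLength w zero    = w
snakeLength w (suc b) = suc (w + suc (snakeLength w b))

snake-origin : ∀ w b → snake w b 0 ≡ (0 , 0)
snake-origin w zero    = refl
snake-origin w (suc b) = refl

InBox : ℕ → ℕ → Point → Set
InBox l₁ l₂ p = proj₁ p ≤ l₁ × proj₂ p ≤ l₂

snake-inBox : ∀ w b t → t ≤ snakeLength w b → InBox (b * 2) w (snake w b t)
snake-inBox w zero    t t≤w = z≤n , t≤w
snake-inBox w (suc b) =
  join-∀ (InBox (suc b * 2) w) (λ t t≤w → z≤n , t≤w)
    (join-∀ (InBox (suc b * 2) w) (λ _ _ → s≤s z≤n , ≤-refl)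
      (λ u u≤ → s≤s (s≤s (proj₁ (snake-inBox w b u u≤))) , m∸n≤m w (proj₂ (snake w b u))))

snake-walk : ∀ w b → InducedWalk (snakeLength w b) (snake w b)
snake-walk w zero    = row-walk
snake-walk w (suc b) =
  join-walk row-walk
    (hook-walk (snake-walk w b) (snake-origin w b) (λ t t≤ → proj₂ (snake-inBox w b t t≤)))
    (row-hook-cross {g = snake w b})

snakeLength-bound : ∀ w b → suc (b * 2) * w ≤ 2 * snakeLength w b
snakeLength-bound w zero    = +-monoʳ-≤ w z≤n
snakeLength-bound w (suc b) = begin
  w + (w + suc (b * 2) * w)     ≤⟨ +-monoʳ-≤ w (+-monoʳ-≤ w (snakeLength-bound w b)) ⟩
  w + (w + 2 * L)               ≤⟨ m≤m+n _ 4 ⟩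
  w + (w + 2 * L) + 4           ≡⟨ solve 2 (λ w L → w :+ (w :+ con 2 :* L) :+ con 4
                                               := con 2 :* (con 1 :+ (w :+ (con 1 :+ L)))) refl w L ⟩
  2 * snakeLength w (suc b)     ∎
  where
  open ≤-Reasoning
  open +-*-Solver
  L : ℕ
  L = snakeLength w b

⌊n/2⌋*2≤n : ∀ n → ⌊ n /2⌋ * 2 ≤ n
⌊n/2⌋*2≤n zero          = z≤n
⌊n/2⌋*2≤n (suc zero)    = z≤n
⌊n/2⌋*2≤n (suc (suc n)) = s≤s (s≤s (⌊n/2⌋*2≤n n))

n≤1+⌊n/2⌋*2 : ∀ n → n ≤ suc (⌊ n /2⌋ * 2)
n≤1+⌊n/2⌋*2 zero          = z≤n
n≤1+⌊n/2⌋*2 (suc zero)    = ≤-refl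
n≤1+⌊n/2⌋*2 (suc (suc n)) = s≤s (s≤s (n≤1+⌊n/2⌋*2 n))

∣n-1+n∣≡1 : ∀ n → ∣ n - suc n ∣ ≡ 1
∣n-1+n∣≡1 n = trans (m≤n⇒∣m-n∣≡n∸m (n≤1+n n)) (m+n∸n≡m 1 n)

consecutive⇒∣-∣≡1 : ∀ {i j} → Consecutive i j → ∣ i - j ∣ ≡ 1
consecutive⇒∣-∣≡1 {i}     (inj₁ refl) = ∣n-1+n∣≡1 i
consecutive⇒∣-∣≡1 {j = j} (inj₂ refl) = trans (∣-∣-comm (suc j) j) (∣n-1+n∣≡1 j)

∣-∣≡1⇒consecutive : ∀ i j → ∣ i - j ∣ ≡ 1 → Consecutive i j
∣-∣≡1⇒consecutive zero    j       j≡1  = inj₁ (sym j≡1)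
∣-∣≡1⇒consecutive (suc i) zero    1+i≡1 = inj₂ (sym 1+i≡1)
∣-∣≡1⇒consecutive (suc i) (suc j) e    = Data.Sum.map (cong suc) (cong suc) (∣-∣≡1⇒consecutive i j e)

m+n≡1 : ∀ m {n} → m + n ≡ 1 → (m ≡ 0 × n ≡ 1) ⊎ (m ≡ 1 × n ≡ 0)
m+n≡1 zero          n≡1 = inj₁ (refl , n≡1)
m+n≡1 (suc zero)    {zero} _ = inj₂ (refl , refl)
m+n≡1 (suc (suc m)) ()

coords : ∀ {l₁ l₂} → V (PathGraph l₁ □ PathGraph l₂) → Point
coords (x , y) = (toℕ x , toℕ y)

vertex : ∀ {l₁ l₂} p → InBox l₁ l₂ p → V (PathGraph l₁ □ PathGraph l₂)
vertex p (r≤l₁ , c≤l₂) = fromℕ< (s≤s r≤l₁) , fromℕ< (s≤s c≤l₂)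

coords-vertex : ∀ {l₁ l₂} p (p∈box : InBox l₁ l₂ p) → coords (vertex p p∈box) ≡ p
coords-vertex p _ = cong₂ _,_ (toℕ-fromℕ< _) (toℕ-fromℕ< _)

grid-adj⇒dist≡1 : ∀ {l₁ l₂} u v → Adj (PathGraph l₁ □ PathGraph l₂) u v →
                  dist (coords u) (coords v) ≡ 1
grid-adj⇒dist≡1 (x , _) _ (inj₁ (refl , c)) = cong₂ _+_ (∣n-n∣≡0 (toℕ x)) (consecutive⇒∣-∣≡1 c)
grid-adj⇒dist≡1 (_ , y) _ (inj₂ (refl , c)) = cong₂ _+_ (consecutive⇒∣-∣≡1 c) (∣n-n∣≡0 (toℕ y))

dist≡1⇒grid-adj : ∀ {l₁ l₂} u v → dist (coords u) (coords v) ≡ 1 →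
                  Adj (PathGraph l₁ □ PathGraph l₂) u v
dist≡1⇒grid-adj (x , y) (x′ , y′) d≡1 with m+n≡1 ∣ toℕ x - toℕ x′ ∣ d≡1
... | inj₁ (dx≡0 , dy≡1) = inj₁ (toℕ-injective (∣m-n∣≡0⇒m≡n dx≡0) , ∣-∣≡1⇒consecutive _ _ dy≡1)
... | inj₂ (dx≡1 , dy≡0) = inj₂ (toℕ-injective (∣m-n∣≡0⇒m≡n dy≡0) , ∣-∣≡1⇒consecutive _ _ dx≡1)

InducedWalk⇒InducedPath : ∀ {l₁ l₂ k f} → InducedWalk k f → (∀ t → t ≤ k → InBox l₁ l₂ (f t)) →
                          InducedPath (PathGraph l₁ □ PathGraph l₂) k
InducedWalk⇒InducedPath {l₁} {l₂} {k} {f} walk inBox = record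
  { vert = vert
  ; inj  = λ {i} {j} vi≡vj → toℕ-injective (∣m-n∣≡0⇒m≡n
             (gap≡ i j (trans (cong (dist (coords (vert i)) ∘ coords) (sym vi≡vj)) (dist-self (coords (vert i)))) z≤n))
  ; adj→ = λ i j c → dist≡1⇒grid-adj (vert i) (vert j) (subst (_≈₂ dist (coords (vert i)) (coords (vert j))) (consecutive⇒∣-∣≡1 c) (gap i j))
  ; adj← = λ i j a → ∣-∣≡1⇒consecutive _ _ (gap≡ i j (grid-adj⇒dist≡1 (vert i) (vert j) a) ≤-refl)
  }
  where
  bound : (i : Fin (suc k)) → toℕ i ≤ k
  bound i = s≤s⁻¹ (toℕ<n i)
  vert : Fin (suc k) → V (PathGraph l₁ □ PathGraph l₂)
  vert i = vertex (f (toℕ i)) (inBox (toℕ i) (bound i))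
  gap : ∀ i j → ∣ toℕ i - toℕ j ∣ ≈₂ dist (coords (vert i)) (coords (vert j))
  gap i j = subst (∣ toℕ i - toℕ j ∣ ≈₂_) (sym (cong₂ dist (coords-vertex (f (toℕ i)) (inBox (toℕ i) (bound i)))
                                                      (coords-vertex (f (toℕ j)) (inBox (toℕ j) (bound j)))))
              (InducedWalk-dist {f = f} walk (bound i) (bound j))
  gap≡ : ∀ i j {x} → dist (coords (vert i)) (coords (vert j)) ≡ x → x ≤ 1 → ∣ toℕ i - toℕ j ∣ ≡ x
  gap≡ i j d≡x = ≈₂-small ∣ toℕ i - toℕ j ∣ (subst (∣ toℕ i - toℕ j ∣ ≈₂_) d≡x (gap i j))

lemma2p9 : (l₁ l₂ : ℕ) → Σ ℕ (λ k → (l₁ * l₂ ≤ 2 * k) × InducedPath (PathGraph l₁ □ PathGraph l₂) k)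
lemma2p9 l₁ l₂ = snakeLength l₂ b , length-bound , InducedWalk⇒InducedPath (snake-walk l₂ b) inBox
  where
  b : ℕ
  b = ⌊ l₁ /2⌋
  length-bound : l₁ * l₂ ≤ 2 * snakeLength l₂ b
  length-bound = ≤-trans (*-monoˡ-≤ l₂ (n≤1+⌊n/2⌋*2 l₁)) (snakeLength-bound l₂ b)
  inBox : ∀ t → t ≤ snakeLength l₂ b → InBox l₁ l₂ (snake l₂ b t)
  inBox t t≤ = Data.Product.map₁ (λ r≤ → ≤-trans r≤ (⌊n/2⌋*2≤n l₁)) (snake-inBox l₂ b t t≤)
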